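{- Let $\frac{p}{q}$ be a Markov fraction, written in lowest terms with $q>0$. Then $p^2+1\equiv 0 \pmod q$.
   Context: Markov fractions are defined as follows. Consider the Markov fraction tree, generated from the neighbouring pair $\big((0,1),(1,2)\big)$ by the Springborn rule: whenever $\big((p_1,q_1),(p_2,q_2)\big)$ is a neighbouring pair (with $p_1/q_1<p_2/q_2$), one forms $$p=\frac{p_1q_1+p_2q_2}{p_2q_1-p_1q_2},\qquad q=\frac{q_1^2+q_2^2}{p_2q_1-p_1q_2},$$ and declares $\big((p_1,q_1),(p,q)\big)$ and $\big((p,q),(p_2,q_2)\big)$ to be neighbouring pairs. Let $\mathcal{MF}_R$ be the set of fractions $p/q$ for all pairs $(p,q)$ occurring in this tree (including $0/1$ and $1/2$); all such $p,q$ are coprime integers, so $p/q$ is in lowest terms. The set of Markov fractions is $\mathcal{MF}=\{n\pm \frac{p}{q}:\ \frac{p}{q}\in\mathcal{MF}_R,\ n\in\mathbb Z\}$. -}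

module Defs where

open import Data.Nat using (ℕ; _+_; _*_; _∸_; _<_; NonZero)
open import Data.Integer as ℤ using (ℤ; +_)
open import Data.Rational as ℚ using (ℚ; _/_)
open import Data.Product using (Σ; ∃; _×_; _,_)
open import Data.Sum using (_⊎_)
open import Relation.Binary.PropositionalEquality using (_≡_)

-- The Springborn rule: with d = p₂q₁ − p₁q₂ (> 0), the new pair (p,q)
-- is given by p = (p₁q₁ + p₂q₂)/d and q = (q₁² + q₂²)/d; we encode the
-- (exact) divisions by the equations p·d = p₁q₁+p₂q₂, q·d = q₁²+q₂².
data Nbr : ℕ → ℕ → ℕ → ℕ → Set where
  root  : Nbr 0 1 1 2
  left  : ∀ {p₁ q₁ p₂ q₂ p q} → Nbr p₁ q₁ p₂ q₂ →
          0 < p₂ * q₁ ∸ p₁ * q₂ →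
          p * (p₂ * q₁ ∸ p₁ * q₂) ≡ p₁ * q₁ + p₂ * q₂ →
          q * (p₂ * q₁ ∸ p₁ * q₂) ≡ q₁ * q₁ + q₂ * q₂ →
          Nbr p₁ q₁ p q
  right : ∀ {p₁ q₁ p₂ q₂ p q} → Nbr p₁ q₁ p₂ q₂ →
          0 < p₂ * q₁ ∸ p₁ * q₂ →
          p * (p₂ * q₁ ∸ p₁ * q₂) ≡ p₁ * q₁ + p₂ * q₂ →
          q * (p₂ * q₁ ∸ p₁ * q₂) ≡ q₁ * q₁ + q₂ * q₂ →
          Nbr p q p₂ q₂

InTree : ℕ → ℕ → Set
InTree p q = (∃ λ p' → ∃ λ q' → Nbr p q p' q') ⊎ (∃ λ p' → ∃ λ q' → Nbr p' q' p q)

MarkovFraction : ℚ → Set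
MarkovFraction x =
  Σ ℤ λ n → Σ ℕ λ p → Σ ℕ λ q → Σ (NonZero q) λ nz → InTree p q ×
    ((x ≡ (n / 1) ℚ.+ _/_ (+ p) q {{nz}}) ⊎ (x ≡ (n / 1) ℚ.- _/_ (+ p) q {{nz}}))

-- Write D = p₂q₁ − p₁q₂ for a neighbouring pair. Every pair in the tree satisfies
-- q₁ ∣ p₁² + 1, q₂ ∣ p₂² + 1, D ∣ p₁² + p₂², and q₁, q₂ are coprime. For the new
-- fraction, (p² + 1)D² = (p₁q₁ + p₂q₂)² + D² = (p₁² + p₂²)(q₁² + q₂²) = (p₁² + p₂²) · qD,
-- so q ∣ p² + 1. The left child (p₁/q₁, p/q) has determinant q₂, and q₂ ∣ p₁² + p²
-- because q₂ divides D²(p₁² + p²) and is coprime to D; the right child is the mirror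
-- image under p ↦ −p. Finally, q ∣ p² + 1 makes p/q a reduced fraction, and this
-- divisibility is preserved by p ↦ p + nq and p ↦ −p.

module Submission where

open import Defs
open import Data.Rational using (ℚ; ↥_; ↧ₙ_)
open import Data.Integer using (_+_; _*_; +_)
open import Data.Integer.Divisibility using (_∣_)

import Data.Nat as ℕ
import Data.Nat.Properties as ℕ
import Data.Nat.Divisibility as ℕ
open import Data.Integer using (ℤ; -_; _-_; NonZero)
open import Data.Integer.Properties
  using (+-comm; *-identityˡ; *-identityʳ; *-cancelʳ-≡; pos-+; pos-*; ⊖-≥; m-n≡m⊖n; neg-involutive)
open import Data.Integer.Divisibility.Signed
  using (divides; ∣ᵤ⇒∣; ∣⇒∣ᵤ; ∣-refl; ∣m∣n⇒∣m+n; ∣n⇒∣m*n; ∣m⇒∣m*n)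
  renaming (_∣_ to _∣ₛ_)
open import Data.Integer.GCD using (gcd; gcd[i,j]∣i; gcd[i,j]∣j)
open import Data.Integer.Tactic.RingSolver using (solve-∀)
import Data.Rational as ℚ
import Data.Rational.Properties as ℚ
import Data.Rational.Unnormalised as ℚᵘ
import Data.Rational.Unnormalised.Properties as ℚᵘ
open import Data.Product using (∃₂; _,_)
open import Data.Sum using (inj₁; inj₂)
open import Relation.Binary.PropositionalEquality
open ≡-Reasoning

Bézout : ℤ → ℤ → Set
Bézout m n = ∃₂ λ a b → a * m + b * n ≡ + 1

Bézout-sym : ∀ {m n} → Bézout m n → Bézout n m
Bézout-sym {m} {n} (a , b , e) = b , a , trans (+-comm (b * n) (a * m)) e

∣sq+1⇒Bézout : ∀ {m n} → m ∣ₛ n * n + + 1 → Bézout m n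
∣sq+1⇒Bézout {m} {n} (divides r e) = r , - n , (begin
  r * m + - n * n          ≡⟨ cong (_+ - n * n) (sym e) ⟩
  n * n + + 1 + - n * n    ≡⟨ cancel n ⟩
  + 1                      ∎)
  where
  cancel : ∀ n → n * n + + 1 + - n * n ≡ + 1
  cancel = solve-∀

Bézout-* : ∀ {m n k} → Bézout m n → Bézout m k → Bézout m (n * k)
Bézout-* {m} {n} {k} (a , b , e) (c , d , f) = a * c * m + a * d * k + b * n * c , b * d , (begin
  (a * c * m + a * d * k + b * n * c) * m + b * d * (n * k) ≡⟨ expand a b c d m n k ⟩
  (a * m + b * n) * (c * m + d * k)                         ≡⟨ cong₂ _*_ e f ⟩
  + 1                                                       ∎)
  where
  expand : ∀ a b c d m n k →
    (a * c * m + a * d * k + b * n * c) * m + b * d * (n * k) ≡ (a * m + b * n) * (c * m + d * k)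
  expand = solve-∀

Bézout-+* : ∀ {m n} k → Bézout m n → Bézout m (k * m + n)
Bézout-+* {m} {n} k (a , b , e) = a - b * k , b , trans (shift a b k m n) e
  where
  shift : ∀ a b k m n → (a - b * k) * m + b * (k * m + n) ≡ a * m + b * n
  shift = solve-∀

Bézout-*⇒ : ∀ {m n k} → Bézout m (n * k) → Bézout m n
Bézout-*⇒ {m} {n} {k} (a , b , e) = a , b * k , trans (regroup a b m n k) e
  where
  regroup : ∀ a b m n k → a * m + b * k * n ≡ a * m + b * (n * k)
  regroup = solve-∀

Bézout-∣ : ∀ {m n k} → Bézout m n → m ∣ₛ n * k → m ∣ₛ k
Bézout-∣ {m} {n} {k} (a , b , e) (divides r f) = divides (a * k + b * r) (begin
  k                          ≡⟨ sym (*-identityˡ k) ⟩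
  + 1 * k                    ≡⟨ cong (_* k) (sym e) ⟩
  (a * m + b * n) * k        ≡⟨ distrib a b k m n ⟩
  a * k * m + b * (n * k)    ≡⟨ cong (λ t → a * k * m + b * t) f ⟩
  a * k * m + b * (r * m)    ≡⟨ collect a b k m r ⟩
  (a * k + b * r) * m        ∎)
  where
  distrib : ∀ a b k m n → (a * m + b * n) * k ≡ a * k * m + b * (n * k)
  distrib = solve-∀
  collect : ∀ a b k m r → a * k * m + b * (r * m) ≡ (a * k + b * r) * m
  collect = solve-∀

Bézout⇒gcd≡1 : ∀ {m n} → Bézout m n → gcd m n ≡ + 1
Bézout⇒gcd≡1 {m} {n} (a , b , e) = cong +_ (ℕ.∣1⇒≡1 (∣⇒∣ᵤ gcd∣1))
  where
  gcd∣1 : gcd m n ∣ₛ + 1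
  gcd∣1 = subst (gcd m n ∣ₛ_) e
    (∣m∣n⇒∣m+n (∣n⇒∣m*n a (∣ᵤ⇒∣ (gcd[i,j]∣i m n))) (∣n⇒∣m*n b (∣ᵤ⇒∣ (gcd[i,j]∣j m n))))

two-squares : ∀ a b c d →
  (a * c + b * d) * (a * c + b * d) + (b * c - a * d) * (b * c - a * d) ≡ (a * a + b * b) * (c * c + d * d)
two-squares = solve-∀

det : ℤ → ℤ → ℤ → ℤ → ℤ
det p₁ q₁ p₂ q₂ = p₂ * q₁ - p₁ * q₂

record SpringbornStep (p₁ q₁ p₂ q₂ p q : ℤ) : Set where
  field
    det≢0 : NonZero (det p₁ q₁ p₂ q₂)
    p-eq  : p * det p₁ q₁ p₂ q₂ ≡ p₁ * q₁ + p₂ * q₂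
    q-eq  : q * det p₁ q₁ p₂ q₂ ≡ q₁ * q₁ + q₂ * q₂

record NeighbourInvariant (p₁ q₁ p₂ q₂ : ℤ) : Set where
  field
    q₁∣p₁²+1    : q₁ ∣ₛ p₁ * p₁ + + 1
    q₂∣p₂²+1    : q₂ ∣ₛ p₂ * p₂ + + 1
    det∣p₁²+p₂² : det p₁ q₁ p₂ q₂ ∣ₛ p₁ * p₁ + p₂ * p₂
    coprime     : Bézout q₁ q₂

module _ {p₁ q₁ p₂ q₂ p q : ℤ} (S : SpringbornStep p₁ q₁ p₂ q₂ p q) where
  open SpringbornStep S

  private
    D : ℤ
    D = det p₁ q₁ p₂ q₂

    cancel-D : ∀ x y → x * D ≡ y * D → x ≡ y
    cancel-D x y = *-cancelʳ-≡ x y D {{det≢0}}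

  q∣p²+1 : det p₁ q₁ p₂ q₂ ∣ₛ p₁ * p₁ + p₂ * p₂ → q ∣ₛ p * p + + 1
  q∣p²+1 (divides c e) = divides c (cancel-D _ _ (cancel-D _ _ (begin
    (p * p + + 1) * D * D                                       ≡⟨ square-out p D ⟩
    (p * D) * (p * D) + D * D                                   ≡⟨ cong (λ t → t * t + D * D) p-eq ⟩
    (p₁ * q₁ + p₂ * q₂) * (p₁ * q₁ + p₂ * q₂) + D * D           ≡⟨ two-squares p₁ p₂ q₁ q₂ ⟩
    (p₁ * p₁ + p₂ * p₂) * (q₁ * q₁ + q₂ * q₂)                   ≡⟨ cong₂ _*_ e (sym q-eq) ⟩
    (c * D) * (q * D)                                           ≡⟨ regroup c D q ⟩
    c * q * D * D                                               ∎)))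
    where
    square-out : ∀ p D → (p * p + + 1) * D * D ≡ (p * D) * (p * D) + D * D
    square-out = solve-∀
    regroup : ∀ c D q → (c * D) * (q * D) ≡ c * q * D * D
    regroup = solve-∀

  det-left-child : det p₁ q₁ p q ≡ q₂
  det-left-child = cancel-D _ _ (begin
    (p * q₁ - p₁ * q) * D                                       ≡⟨ distrib p q₁ p₁ q D ⟩
    (p * D) * q₁ - p₁ * (q * D)                                 ≡⟨ cong₂ (λ s t → s * q₁ - p₁ * t) p-eq q-eq ⟩
    (p₁ * q₁ + p₂ * q₂) * q₁ - p₁ * (q₁ * q₁ + q₂ * q₂)         ≡⟨ factor p₁ q₁ p₂ q₂ ⟩
    q₂ * D                                                      ∎)
    where
    distrib : ∀ p q₁ p₁ q D → (p * q₁ - p₁ * q) * D ≡ (p * D) * q₁ - p₁ * (q * D)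
    distrib = solve-∀
    factor : ∀ p₁ q₁ p₂ q₂ →
      (p₁ * q₁ + p₂ * q₂) * q₁ - p₁ * (q₁ * q₁ + q₂ * q₂) ≡ q₂ * (p₂ * q₁ - p₁ * q₂)
    factor = solve-∀

  Bézout-q₁-q : Bézout q₁ q₂ → Bézout q₁ q
  Bézout-q₁-q b₁₂ = Bézout-*⇒ (subst (Bézout q₁) (sym q-eq) (Bézout-+* q₁ (Bézout-* b₁₂ b₁₂)))

  Bézout-q₂-det : q₂ ∣ₛ p₂ * p₂ + + 1 → Bézout q₁ q₂ → Bézout q₂ (det p₁ q₁ p₂ q₂)
  Bézout-q₂-det q₂∣p₂²+1 b₁₂ = subst (Bézout q₂) (expand p₁ q₁ p₂ q₂)
    (Bézout-+* (- p₁) (Bézout-* (∣sq+1⇒Bézout {n = p₂} q₂∣p₂²+1) (Bézout-sym b₁₂)))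
    where
    expand : ∀ p₁ q₁ p₂ q₂ → - p₁ * q₂ + p₂ * q₁ ≡ p₂ * q₁ - p₁ * q₂
    expand = solve-∀

  -- Multiplied by D², the sum becomes p₁²q₁²(p₂² + 1) modulo q₂.
  q₂∣p₁²+p² : q₂ ∣ₛ p₂ * p₂ + + 1 → Bézout q₁ q₂ → q₂ ∣ₛ p₁ * p₁ + p * p
  q₂∣p₁²+p² q₂∣p₂²+1 b₁₂ = Bézout-∣ (Bézout-* b₂D b₂D) (subst (q₂ ∣ₛ_) (sym scaled)
    (∣m∣n⇒∣m+n (∣n⇒∣m*n (p₁ * p₁ * q₁ * q₁) q₂∣p₂²+1) (∣m⇒∣m*n X ∣-refl)))
    where
    b₂D : Bézout q₂ D
    b₂D = Bézout-q₂-det q₂∣p₂²+1 b₁₂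
    X : ℤ
    X = p₁ * p₁ * p₁ * p₁ * q₂ - + 2 * p₁ * p₁ * p₁ * p₂ * q₁ + + 2 * p₁ * p₂ * q₁ + p₂ * p₂ * q₂
    distrib : ∀ D p₁ p → D * D * (p₁ * p₁ + p * p) ≡ p₁ * p₁ * (D * D) + (p * D) * (p * D)
    distrib = solve-∀
    reduce : ∀ p₁ q₁ p₂ q₂ →
      p₁ * p₁ * ((p₂ * q₁ - p₁ * q₂) * (p₂ * q₁ - p₁ * q₂)) + (p₁ * q₁ + p₂ * q₂) * (p₁ * q₁ + p₂ * q₂)
      ≡ p₁ * p₁ * q₁ * q₁ * (p₂ * p₂ + + 1)
        + q₂ * (p₁ * p₁ * p₁ * p₁ * q₂ - + 2 * p₁ * p₁ * p₁ * p₂ * q₁ + + 2 * p₁ * p₂ * q₁ + p₂ * p₂ * q₂)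
    reduce = solve-∀
    scaled : D * D * (p₁ * p₁ + p * p) ≡ p₁ * p₁ * q₁ * q₁ * (p₂ * p₂ + + 1) + q₂ * X
    scaled = begin
      D * D * (p₁ * p₁ + p * p)                                          ≡⟨ distrib D p₁ p ⟩
      p₁ * p₁ * (D * D) + (p * D) * (p * D)                              ≡⟨ cong (λ t → p₁ * p₁ * (D * D) + t * t) p-eq ⟩
      p₁ * p₁ * (D * D) + (p₁ * q₁ + p₂ * q₂) * (p₁ * q₁ + p₂ * q₂)      ≡⟨ reduce p₁ q₁ p₂ q₂ ⟩
      p₁ * p₁ * q₁ * q₁ * (p₂ * p₂ + + 1) + q₂ * X                        ∎

  left-child : NeighbourInvariant p₁ q₁ p₂ q₂ → NeighbourInvariant p₁ q₁ p q
  left-child I = record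
    { q₁∣p₁²+1    = q₁∣p₁²+1
    ; q₂∣p₂²+1    = q∣p²+1 det∣p₁²+p₂²
    ; det∣p₁²+p₂² = subst (_∣ₛ p₁ * p₁ + p * p) (sym det-left-child) (q₂∣p₁²+p² q₂∣p₂²+1 coprime)
    ; coprime     = Bézout-q₁-q coprime
    }
    where open NeighbourInvariant I

neg-square : ∀ x → - x * - x ≡ x * x
neg-square = solve-∀

det-reflect : ∀ p₁ q₁ p₂ q₂ → det (- p₂) q₂ (- p₁) q₁ ≡ det p₁ q₁ p₂ q₂
det-reflect p₁ q₁ p₂ q₂ = expanded p₁ q₁ p₂ q₂
  where
  expanded : ∀ p₁ q₁ p₂ q₂ → - p₁ * q₂ - - p₂ * q₁ ≡ p₂ * q₁ - p₁ * q₂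
  expanded = solve-∀

module _ {p₁ q₁ p₂ q₂ : ℤ} where

  reflect-step : ∀ {p q} → SpringbornStep p₁ q₁ p₂ q₂ p q → SpringbornStep (- p₂) q₂ (- p₁) q₁ (- p) q
  reflect-step {p} {q} S = record
    { det≢0 = subst NonZero (sym D≡) det≢0
    ; p-eq  = begin
        - p * det (- p₂) q₂ (- p₁) q₁   ≡⟨ cong (- p *_) D≡ ⟩
        - p * det p₁ q₁ p₂ q₂           ≡⟨ neg-scale p (det p₁ q₁ p₂ q₂) ⟩
        - (p * det p₁ q₁ p₂ q₂)         ≡⟨ cong -_ p-eq ⟩
        - (p₁ * q₁ + p₂ * q₂)           ≡⟨ neg-swap p₁ q₁ p₂ q₂ ⟩
        - p₂ * q₂ + - p₁ * q₁           ∎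
    ; q-eq  = trans (cong (q *_) D≡) (trans q-eq (+-comm (q₁ * q₁) (q₂ * q₂)))
    }
    where
    open SpringbornStep S
    D≡ : det (- p₂) q₂ (- p₁) q₁ ≡ det p₁ q₁ p₂ q₂
    D≡ = det-reflect p₁ q₁ p₂ q₂
    neg-scale : ∀ p D → - p * D ≡ - (p * D)
    neg-scale = solve-∀
    neg-swap : ∀ p₁ q₁ p₂ q₂ → - (p₁ * q₁ + p₂ * q₂) ≡ - p₂ * q₂ + - p₁ * q₁
    neg-swap = solve-∀

  reflect-invariant : NeighbourInvariant p₁ q₁ p₂ q₂ → NeighbourInvariant (- p₂) q₂ (- p₁) q₁
  reflect-invariant I = record
    { q₁∣p₁²+1    = subst (λ t → q₂ ∣ₛ t + + 1) (sym (neg-square p₂)) q₂∣p₂²+1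
    ; q₂∣p₂²+1    = subst (λ t → q₁ ∣ₛ t + + 1) (sym (neg-square p₁)) q₁∣p₁²+1
    ; det∣p₁²+p₂² = subst₂ _∣ₛ_ (sym (det-reflect p₁ q₁ p₂ q₂)) (sum-swap p₁ p₂) det∣p₁²+p₂²
    ; coprime     = Bézout-sym coprime
    }
    where
    open NeighbourInvariant I
    sum-swap : ∀ p₁ p₂ → p₁ * p₁ + p₂ * p₂ ≡ - p₂ * - p₂ + - p₁ * - p₁
    sum-swap = solve-∀

right-child : ∀ {p₁ q₁ p₂ q₂ p q} → SpringbornStep p₁ q₁ p₂ q₂ p q →
              NeighbourInvariant p₁ q₁ p₂ q₂ → NeighbourInvariant p q p₂ q₂
right-child {p₂ = p₂} {p = p} S I =
  subst₂ (λ x y → NeighbourInvariant x _ y _) (neg-involutive p) (neg-involutive p₂)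
    (reflect-invariant (left-child (reflect-step S) (reflect-invariant I)))

pos-∸ : ∀ m n → n ℕ.≤ m → + (m ℕ.∸ n) ≡ + m - + n
pos-∸ m n n≤m = sym (trans (m-n≡m⊖n m n) (⊖-≥ n≤m))

pos-*≡*+* : ∀ x d a b c e → x ℕ.* d ≡ a ℕ.* b ℕ.+ c ℕ.* e → + x * + d ≡ + a * + b + + c * + e
pos-*≡*+* x d a b c e h = begin
  + x * + d                  ≡⟨ pos-* x d ⟨
  + (x ℕ.* d)                ≡⟨ cong +_ h ⟩
  + (a ℕ.* b ℕ.+ c ℕ.* e)    ≡⟨ pos-+ (a ℕ.* b) (c ℕ.* e) ⟩
  + (a ℕ.* b) + + (c ℕ.* e)  ≡⟨ cong₂ _+_ (pos-* a b) (pos-* c e) ⟩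
  + a * + b + + c * + e      ∎

pos-springbornStep : ∀ {p₁ q₁ p₂ q₂ p q} →
  let d = p₂ ℕ.* q₁ ℕ.∸ p₁ ℕ.* q₂ in
  0 ℕ.< d → p ℕ.* d ≡ p₁ ℕ.* q₁ ℕ.+ p₂ ℕ.* q₂ → q ℕ.* d ≡ q₁ ℕ.* q₁ ℕ.+ q₂ ℕ.* q₂ →
  SpringbornStep (+ p₁) (+ q₁) (+ p₂) (+ q₂) (+ p) (+ q)
pos-springbornStep {p₁} {q₁} {p₂} {q₂} {p} {q} 0<d p-eq q-eq = record
  { det≢0 = subst NonZero d≡det (ℕ.>-nonZero 0<d)
  ; p-eq  = trans (cong (+ p *_) (sym d≡det)) (pos-*≡*+* p _ p₁ q₁ p₂ q₂ p-eq)
  ; q-eq  = trans (cong (+ q *_) (sym d≡det)) (pos-*≡*+* q _ q₁ q₁ q₂ q₂ q-eq)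
  }
  where
  d≡det : + (p₂ ℕ.* q₁ ℕ.∸ p₁ ℕ.* q₂) ≡ det (+ p₁) (+ q₁) (+ p₂) (+ q₂)
  d≡det = trans (pos-∸ (p₂ ℕ.* q₁) (p₁ ℕ.* q₂) (ℕ.<⇒≤ (ℕ.m∸n≢0⇒n<m (ℕ.>⇒≢ 0<d))))
                (cong₂ _-_ (pos-* p₂ q₁) (pos-* p₁ q₂))

neighbour-invariant : ∀ {p₁ q₁ p₂ q₂} → Nbr p₁ q₁ p₂ q₂ → NeighbourInvariant (+ p₁) (+ q₁) (+ p₂) (+ q₂)
neighbour-invariant root = record
  { q₁∣p₁²+1    = divides (+ 1) refl
  ; q₂∣p₂²+1    = divides (+ 1) refl
  ; det∣p₁²+p₂² = divides (+ 1) refl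
  ; coprime     = + 1 , + 0 , refl
  }
neighbour-invariant (left n 0<d p-eq q-eq)  = left-child (pos-springbornStep 0<d p-eq q-eq) (neighbour-invariant n)
neighbour-invariant (right n 0<d p-eq q-eq) = right-child (pos-springbornStep 0<d p-eq q-eq) (neighbour-invariant n)

tree-∣sq+1 : ∀ {p q} → InTree p q → + q ∣ₛ + p * + p + + 1
tree-∣sq+1 (inj₁ (_ , _ , n)) = NeighbourInvariant.q₁∣p₁²+1 (neighbour-invariant n)
tree-∣sq+1 (inj₂ (_ , _ , n)) = NeighbourInvariant.q₂∣p₂²+1 (neighbour-invariant n)

↧∣↥²+1 : ℚ → Set
↧∣↥²+1 x = + (↧ₙ x) ∣ ↥ x * ↥ x + + 1

∣sq+1-shift : ∀ {m} n s → m ∣ₛ s * s + + 1 → m ∣ₛ (n * m + s) * (n * m + s) + + 1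
∣sq+1-shift {m} n s m∣s²+1 = subst (m ∣ₛ_) (sym (expand n m s))
  (∣m∣n⇒∣m+n (∣m⇒∣m*n (n * n * m + + 2 * n * s) ∣-refl) m∣s²+1)
  where
  expand : ∀ n m s → (n * m + s) * (n * m + s) + + 1 ≡ m * (n * n * m + + 2 * n * s) + (s * s + + 1)
  expand = solve-∀

↧∣↥²+1-/ : ∀ m q .{{_ : ℕ.NonZero q}} → + q ∣ₛ m * m + + 1 → ↧∣↥²+1 (m ℚ./ q)
↧∣↥²+1-/ m q q∣m²+1 = ∣⇒∣ᵤ (subst₂ _∣ₛ_ (sym ↧≡q) (cong (λ t → t * t + + 1) (sym ↥≡m)) q∣m²+1)
  where
  gcd≡1 : gcd m (+ q) ≡ + 1
  gcd≡1 = Bézout⇒gcd≡1 (Bézout-sym (∣sq+1⇒Bézout {n = m} q∣m²+1))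
  reduced : ∀ {x y} → x * gcd m (+ q) ≡ y → x ≡ y
  reduced {x} h = trans (sym (*-identityʳ x)) (trans (cong (x *_) (sym gcd≡1)) h)
  ↥≡m : ↥ (m ℚ./ q) ≡ m
  ↥≡m = reduced (ℚ.↥-/ m q)
  ↧≡q : ℚ.↧ (m ℚ./ q) ≡ + q
  ↧≡q = reduced (ℚ.↧-/ m q)

↧∣↥²+1-neg : ∀ x → ↧∣↥²+1 x → ↧∣↥²+1 (ℚ.- x)
↧∣↥²+1-neg x = subst₂ _∣_ (sym (ℚ.↧-neg x))
  (trans (sym (cong (_+ + 1) (neg-square (↥ x)))) (cong (λ t → t * t + + 1) (sym (ℚ.↥-neg x))))

/1-+ : ∀ n x → n ℚ./ 1 ℚ.+ x ≡ (n * ℚ.↧ x + ↥ x) ℚ./ ↧ₙ x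
/1-+ n x@(ℚ.mkℚ s k _) = ℚ.toℚᵘ-injective (ℚᵘ.≃-trans (ℚ.toℚᵘ-homo-+ (n ℚ./ 1) x)
  (ℚᵘ.≃-trans (ℚᵘ.+-congˡ (ℚᵘ.mkℚᵘ s k) (ℚ.toℚᵘ-fromℚᵘ (ℚᵘ.mkℚᵘ n 0)))
  (ℚᵘ.≃-trans (ℚᵘ.*≡* (cross n s (+ ℕ.suc k)))
  (ℚᵘ.≃-sym (ℚ.toℚᵘ-fromℚᵘ (ℚᵘ.mkℚᵘ (n * + ℕ.suc k + s) k))))))
  where
  cross : ∀ n s K → (n * K + s * + 1) * K ≡ (n * K + s) * (+ 1 * K)
  cross = solve-∀

↧∣↥²+1-+ : ∀ n x → ↧∣↥²+1 x → ↧∣↥²+1 (n ℚ./ 1 ℚ.+ x)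
↧∣↥²+1-+ n x h =
  subst ↧∣↥²+1 (sym (/1-+ n x)) (↧∣↥²+1-/ (n * ℚ.↧ x + ↥ x) (↧ₙ x) (∣sq+1-shift n (↥ x) (∣ᵤ⇒∣ h)))

↧∣↥²+1-tree : ∀ p q .{{_ : ℕ.NonZero q}} → InTree p q → ↧∣↥²+1 (+ p ℚ./ q)
↧∣↥²+1-tree p q t = ↧∣↥²+1-/ (+ p) q (tree-∣sq+1 t)

proposition2p3 : (x : ℚ) → MarkovFraction x →
    (+ (↧ₙ x)) ∣ ((↥ x) * (↥ x) + + 1)
proposition2p3 x (n , p , q , q≢0 , t , inj₁ x≡n+p/q) =
  subst ↧∣↥²+1 (sym x≡n+p/q) (↧∣↥²+1-+ n p/q (↧∣↥²+1-tree p q {{q≢0}} t))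
  where
  p/q : ℚ
  p/q = ℚ._/_ (+ p) q {{q≢0}}
proposition2p3 x (n , p , q , q≢0 , t , inj₂ x≡n-p/q) =
  subst ↧∣↥²+1 (sym x≡n-p/q) (↧∣↥²+1-+ n (ℚ.- p/q) (↧∣↥²+1-neg p/q (↧∣↥²+1-tree p q {{q≢0}} t)))
  where
  p/q : ℚ
  p/q = ℚ._/_ (+ p) q {{q≢0}}
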